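{- Let $p,q,z,k$ be positive integers and let $\chi:[pz]\times[qz]\to[k]$ be a coloring of the $pz\times qz$ grid with no monochromatic rectangle, in which every $z\times z$ subgrid $B_{i,j}$ ($i\in[p]$, $j\in[q]$) has the right shift pattern. For each color $c$, block row $i$ and block column $j$, let $v_{c,i,j}$ be the number of cells of $B_{i,j}$ colored $c$, divided by $z$, and let $\mathbf v_{c,j}=(v_{c,1,j},\dots,v_{c,p,j})^{T}$. Then for every color $c\in[k]$ and every pair of distinct block columns $j_1\ne j_2$ in $[q]$, $\mathbf v_{c,j_1}\cdot\mathbf v_{c,j_2}=\sum_{i=1}^{p}v_{c,i,j_1}v_{c,i,j_2}\le z$.
   Context: Cells are $(r,s)$ with $r$ the row and $s$ the column. A monochromatic rectangle is a set of four distinct cells $(a,b),(a,d),(c,b),(c,d)$ all of the same color. The subgrid $B_{i,j}$ consists of the cells with rows $(i-1)z+1,\dots,iz$ and columns $(j-1)z+1,\dots,jz$; with local coordinates $(r,s)\in[z]\times[z]$, $B_{i,j}$ has the right shift pattern if the color at local position $(r,s)$ equals the color at local position $(1,((s-r)\bmod z)+1)$ for all $r,s$ (each row is the first row cyclically shifted right by $r-1$). -}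

module Defs where

open import Data.Nat using (ℕ; zero; suc; _+_; _*_; _∸_; _<_; NonZero; >-nonZero⁻¹)
open import Data.Nat.DivMod using (_%_; m%n<n)
open import Data.Fin using (Fin; toℕ; fromℕ<; combine)
open import Data.List using (List; map; foldr; allFin)
import Data.List as L
open import Data.Bool using (if_then_else_)
open import Data.Fin using (_≟_)
open import Relation.Nullary.Decidable using (⌊_⌋)
open import Relation.Binary.PropositionalEquality using (_≡_; _≢_)
open import Relation.Nullary using (¬_)
open import Data.Product using (_×_)
open import Data.Integer using (+_)
open import Data.Rational using (ℚ; _/_; 0ℚ)
import Data.Rational as Q

Coloring : ℕ → ℕ → ℕ → Set
Coloring m n k = Fin m → Fin n → Fin k

-- No four distinct cells (a,b),(a,d),(c,b),(c,d) share a color.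
-- The four cells are distinct iff a ≢ c and b ≢ d.
NoMonoRect : ∀ {m n k} → Coloring m n k → Set
NoMonoRect {m} {n} χ =
  (a c : Fin m) (b d : Fin n) → a ≢ c → b ≢ d →
  ¬ (χ a b ≡ χ a d × χ a b ≡ χ c b × χ a b ≡ χ c d)

-- Cell of block B_{i,j} at local position (r,s) (all 0-based):
-- global row i*z + r, global column j*z + s.
blockColor : ∀ {p q z k} → Coloring (p * z) (q * z) k →
             Fin p → Fin q → Fin z → Fin z → Fin k
blockColor χ i j r s = χ (combine i r) (combine j s)

-- 0-based version of the local column ((s - r) mod z) + 1 (1-based).
shiftIdx : (z : ℕ) .{{_ : NonZero z}} → Fin z → Fin z → Fin z
shiftIdx z r s = fromℕ< (m%n<n ((z ∸ toℕ r) + toℕ s) z)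

firstIdx : (z : ℕ) .{{_ : NonZero z}} → Fin z
firstIdx z = fromℕ< (>-nonZero⁻¹ z)

RightShift : ∀ {p q z k} .{{_ : NonZero z}} → Coloring (p * z) (q * z) k →
             Fin p → Fin q → Set
RightShift {z = z} χ i j = (r s : Fin z) →
  blockColor χ i j r s ≡ blockColor χ i j (firstIdx z) (shiftIdx z r s)

sumℕ : ∀ {n} → (Fin n → ℕ) → ℕ
sumℕ {n} f = foldr _+_ 0 (map f (allFin n))

sumℚ : ∀ {n} → (Fin n → ℚ) → ℚ
sumℚ {n} f = foldr Q._+_ 0ℚ (map f (allFin n))

countBlock : ∀ {p q z k} → Coloring (p * z) (q * z) k →
             Fin k → Fin p → Fin q → ℕ
countBlock {z = z} χ c i j =
  sumℕ {z} λ r → sumℕ {z} λ s → if ⌊ blockColor χ i j r s ≟ c ⌋ then 1 else 0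

v : ∀ {p q z k} .{{_ : NonZero z}} → Coloring (p * z) (q * z) k →
    Fin k → Fin p → Fin q → ℚ
v {z = z} χ c i j = (+ countBlock χ c i j) / z

dot : ∀ {p q z k} .{{_ : NonZero z}} → Coloring (p * z) (q * z) k →
      Fin k → Fin q → Fin q → ℚ
dot {p = p} χ c j₁ j₂ = sumℚ {p} λ i → v χ c i j₁ Q.* v χ c i j₂

-- Each row of a right-shift block is a cyclic shift of its first row, so every row of B_{i,j} has
-- the same number n_{i,j} of cells of colour c, and v_{c,i,j} = n_{i,j}. Count the pairs of
-- c-coloured cells in a common grid row, one in block column j₁ and one in block column j₂: row by
-- row there are z Σᵢ n_{i,j₁} n_{i,j₂} of them, while each fixed pair of columns carries at most one
-- such pair, since two would span a monochromatic rectangle. Hence z Σᵢ n_{i,j₁} n_{i,j₂} ≤ z².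
module Submission where

open import Defs
open import Data.Nat using (ℕ; zero; suc; _+_; _*_; _∸_; z≤n; s≤s; NonZero)
import Data.Nat as ℕ
open import Data.Nat.Properties
  using (+-*-semiring; +-assoc; +-comm; *-comm; *-identityʳ; +-mono-≤; *-mono-≤; *-cancelˡ-≤;
         ≤-refl; ≤-reflexive; <⇒≤; ≮⇒≥; n≮0; n≤0⇒n≡0; n≤1⇒n≡0∨n≡1; m∸n+n≡m; m+[n∸m]≡n; module ≤-Reasoning)
open import Data.Nat.DivMod using (_%_; m%n<n; m%n%n≡m%n; %-distribˡ-+; [m+n]%n≡m%n; m<n⇒m%n≡m)
open import Data.Fin using (Fin; zero; suc; toℕ; fromℕ<; combine; _↑ˡ_; _↑ʳ_; _≟_)
import Data.Fin.Properties as Finₚ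
open import Data.Fin.Permutation using (Permutation′; permutation)
import Data.Vec.Functional as Vector
import Data.List as List
open import Data.List.Properties using (map-tabulate)
open import Data.Bool using (if_then_else_)
open import Data.Product using (_×_; _,_; proj₁)
open import Data.Sum using (inj₁; inj₂)
open import Data.Integer using (+_)
import Data.Integer as ℤ
import Data.Integer.Properties as ℤ
open import Data.Rational using (ℚ; _≤_; _/_; toℚᵘ)
import Data.Rational as ℚ
import Data.Rational.Properties as ℚ
open import Data.Rational.Unnormalised as ℚᵘ using (ℚᵘ; mkℚᵘ; *≡*; *≤*)
import Data.Rational.Unnormalised.Properties as ℚᵘ
open import Function using (_∘_; id)
open import Relation.Nullary using (yes; no; contradiction)
open import Relation.Nullary.Decidable using (⌊_⌋)
open import Relation.Binary.PropositionalEquality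

open import Algebra.Properties.Semiring.Sum +-*-semiring
  using (sum; sum-cong-≗; sum-replicate-zero; ∑-comm; *-distribˡ-sum; *-distribʳ-sum; sum-permute)

foldr-map-allFin : ∀ {A B : Set} (_∙_ : A → B → B) (e : B) {n} (f : Fin n → A) →
  List.foldr _∙_ e (List.map f (List.allFin n)) ≡ Vector.foldr _∙_ e f
foldr-map-allFin {A} _∙_ e {n} f = trans (cong (List.foldr _∙_ e) (map-tabulate id f)) (foldr-tabulate f)
  where
  foldr-tabulate : ∀ {m} (g : Fin m → A) → List.foldr _∙_ e (List.tabulate g) ≡ Vector.foldr _∙_ e g
  foldr-tabulate {zero} g = refl
  foldr-tabulate {suc m} g = cong (g zero ∙_) (foldr-tabulate (g ∘ suc))

sumℕ≡sum : ∀ {n} (f : Fin n → ℕ) → sumℕ f ≡ sum f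
sumℕ≡sum = foldr-map-allFin _+_ 0

sum-const : ∀ n a → sum {n} (λ _ → a) ≡ n * a
sum-const zero a = refl
sum-const (suc n) a = cong (_+_ a) (sum-const n a)

sum-mono-≤ : ∀ {n} {f g : Fin n → ℕ} → (∀ x → f x ℕ.≤ g x) → sum f ℕ.≤ sum g
sum-mono-≤ {zero} f≤g = z≤n
sum-mono-≤ {suc n} f≤g = +-mono-≤ (f≤g zero) (sum-mono-≤ (f≤g ∘ suc))

sum-*-sum : ∀ {m n} (f : Fin m → ℕ) (g : Fin n → ℕ) →
  sum f * sum g ≡ sum (λ x → sum (λ y → f x * g y))
sum-*-sum f g = trans (*-distribʳ-sum (sum g) f) (sum-cong-≗ (λ x → *-distribˡ-sum (f x) g))

sum-↑ : ∀ m {n} (f : Fin (m + n) → ℕ) → sum f ≡ sum (f ∘ (_↑ˡ n)) + sum (f ∘ (m ↑ʳ_))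
sum-↑ zero f = refl
sum-↑ (suc m) f = trans (cong (_+_ (f zero)) (sum-↑ m (f ∘ suc))) (sym (+-assoc (f zero) _ _))

sum-combine : ∀ m {n} (f : Fin (m * n) → ℕ) → sum f ≡ sum {m} (λ i → sum {n} (λ r → f (combine i r)))
sum-combine zero f = refl
sum-combine (suc m) {n} f =
  trans (sum-↑ n f) (cong (_+_ (sum (λ r → f (r ↑ˡ (m * n))))) (sum-combine m (λ x → f (n ↑ʳ x))))

sum≤1 : ∀ {n} (f : Fin n → ℕ) → (∀ x → f x ℕ.≤ 1) → (∀ x y → 0 ℕ.< f x → 0 ℕ.< f y → x ≡ y) → sum f ℕ.≤ 1
sum≤1 {zero} f f≤1 unique = z≤n
sum≤1 {suc n} f f≤1 unique with n≤1⇒n≡0∨n≡1 (f≤1 zero)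
... | inj₁ f₀≡0 rewrite f₀≡0 =
  sum≤1 (f ∘ suc) (f≤1 ∘ suc) (λ x y fx>0 fy>0 → Finₚ.suc-injective (unique (suc x) (suc y) fx>0 fy>0))
... | inj₂ f₀≡1 rewrite f₀≡1 = s≤s (≤-reflexive (trans (sum-cong-≗ rest≡0) (sum-replicate-zero n)))
  where
  rest≡0 : ∀ x → f (suc x) ≡ 0
  rest≡0 x = n≤0⇒n≡0 (≮⇒≥ (λ fx>0 → Finₚ.0≢1+n (unique zero (suc x) (≤-reflexive (sym f₀≡1)) fx>0)))

+-%-inverse : ∀ {z} .{{_ : NonZero z}} a b {t} → a + b ≡ z → t ℕ.< z → (a + (b + t) % z) % z ≡ t
+-%-inverse {z} a b {t} a+b≡z t<z = begin
  (a + (b + t) % z) % z           ≡⟨ %-distribˡ-+ a ((b + t) % z) z ⟩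
  (a % z + (b + t) % z % z) % z   ≡⟨ cong (λ x → (a % z + x) % z) (m%n%n≡m%n (b + t) z) ⟩
  (a % z + (b + t) % z) % z       ≡⟨ %-distribˡ-+ a (b + t) z ⟨
  (a + (b + t)) % z               ≡⟨ cong (_% z) (+-assoc a b t) ⟨
  (a + b + t) % z                 ≡⟨ cong (λ x → (x + t) % z) a+b≡z ⟩
  (z + t) % z                     ≡⟨ cong (_% z) (+-comm z t) ⟩
  (t + z) % z                     ≡⟨ [m+n]%n≡m%n t z ⟩
  t % z                           ≡⟨ m<n⇒m%n≡m t<z ⟩
  t                               ∎
  where open ≡-Reasoning

rightShift : ∀ z .{{_ : NonZero z}} → Fin z → Permutation′ z
rightShift z r = permutation (shiftIdx z r) leftShift shift∘leftShift leftShift∘shift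
  where
  r≤z : toℕ r ℕ.≤ z
  r≤z = <⇒≤ (Finₚ.toℕ<n r)

  leftShift : Fin z → Fin z
  leftShift t = fromℕ< (m%n<n (toℕ r + toℕ t) z)

  shift∘leftShift : ∀ t → shiftIdx z r (leftShift t) ≡ t
  shift∘leftShift t = Finₚ.toℕ-injective (begin
    toℕ (shiftIdx z r (leftShift t))              ≡⟨ Finₚ.toℕ-fromℕ< _ ⟩
    (z ∸ toℕ r + toℕ (leftShift t)) % z          ≡⟨ cong (λ x → (z ∸ toℕ r + x) % z) (Finₚ.toℕ-fromℕ< _) ⟩
    (z ∸ toℕ r + (toℕ r + toℕ t) % z) % z        ≡⟨ +-%-inverse (z ∸ toℕ r) (toℕ r) (m∸n+n≡m r≤z) (Finₚ.toℕ<n t) ⟩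
    toℕ t                                        ∎)
    where open ≡-Reasoning

  leftShift∘shift : ∀ s → leftShift (shiftIdx z r s) ≡ s
  leftShift∘shift s = Finₚ.toℕ-injective (begin
    toℕ (leftShift (shiftIdx z r s))             ≡⟨ Finₚ.toℕ-fromℕ< _ ⟩
    (toℕ r + toℕ (shiftIdx z r s)) % z           ≡⟨ cong (λ x → (toℕ r + x) % z) (Finₚ.toℕ-fromℕ< _) ⟩
    (toℕ r + (z ∸ toℕ r + toℕ s) % z) % z        ≡⟨ +-%-inverse (toℕ r) (z ∸ toℕ r) (m+[n∸m]≡n r≤z) (Finₚ.toℕ<n s) ⟩
    toℕ s                                        ∎)
    where open ≡-Reasoning

sum-shiftIdx : ∀ {z} .{{_ : NonZero z}} (f : Fin z → ℕ) r → sum (f ∘ shiftIdx z r) ≡ sum f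
sum-shiftIdx {z} f r = sym (sum-permute f (rightShift z r))

𝟙[_≡_] : ∀ {k} → Fin k → Fin k → ℕ
𝟙[ x ≡ c ] = if ⌊ x ≟ c ⌋ then 1 else 0

𝟙≤1 : ∀ {k} (x c : Fin k) → 𝟙[ x ≡ c ] ℕ.≤ 1
𝟙≤1 x c with x ≟ c
... | yes _ = ≤-refl
... | no _ = z≤n

𝟙*𝟙-pos : ∀ {k} (x y c : Fin k) → 0 ℕ.< 𝟙[ x ≡ c ] * 𝟙[ y ≡ c ] → x ≡ c × y ≡ c
𝟙*𝟙-pos x y c pos with x ≟ c | y ≟ c
... | yes x≡c | yes y≡c = x≡c , y≡c
... | yes _   | no _    = contradiction pos n≮0
... | no _    | _       = contradiction pos n≮0

module _ {m n k} (χ : Coloring m n k) (c : Fin k) where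

  colorCount : ∀ {w} → (Fin w → Fin n) → Fin m → ℕ
  colorCount cols a = sum (λ s → 𝟙[ χ a (cols s) ≡ c ])

  commonRows≤1 : NoMonoRect χ → ∀ {b d} → b ≢ d → sum (λ a → 𝟙[ χ a b ≡ c ] * 𝟙[ χ a d ≡ c ]) ℕ.≤ 1
  commonRows≤1 noRect {b} {d} b≢d = sum≤1 _ (λ a → *-mono-≤ (𝟙≤1 (χ a b) c) (𝟙≤1 (χ a d) c)) sameRow
    where
    sameRow : ∀ a a' → 0 ℕ.< 𝟙[ χ a b ≡ c ] * 𝟙[ χ a d ≡ c ] → 0 ℕ.< 𝟙[ χ a' b ≡ c ] * 𝟙[ χ a' d ≡ c ] → a ≡ a'
    sameRow a a' pos pos' with a ≟ a' | 𝟙*𝟙-pos (χ a b) (χ a d) c pos | 𝟙*𝟙-pos (χ a' b) (χ a' d) c pos'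
    ... | yes a≡a' | _ | _ = a≡a'
    ... | no a≢a' | ab , ad | a'b , a'd =
      contradiction (trans ab (sym ad) , trans ab (sym a'b) , trans ab (sym a'd)) (noRect a a' b d a≢a' b≢d)

  sum-colorCount*colorCount≤ : NoMonoRect χ → ∀ {w} (cols₁ cols₂ : Fin w → Fin n) →
    (∀ s t → cols₁ s ≢ cols₂ t) → sum (λ a → colorCount cols₁ a * colorCount cols₂ a) ℕ.≤ w * w
  sum-colorCount*colorCount≤ noRect {w} cols₁ cols₂ disjoint = begin
    sum (λ a → colorCount cols₁ a * colorCount cols₂ a)   ≡⟨ sum-cong-≗ (λ a → sum-*-sum (isC a cols₁) (isC a cols₂)) ⟩
    sum (λ a → sum (λ s → sum (λ t → E a s t)))           ≡⟨ ∑-comm (λ a s → sum (E a s)) ⟩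
    sum (λ s → sum (λ a → sum (λ t → E a s t)))           ≡⟨ sum-cong-≗ (λ s → ∑-comm (λ a t → E a s t)) ⟩
    sum (λ s → sum (λ t → sum (λ a → E a s t)))
      ≤⟨ sum-mono-≤ (λ s → sum-mono-≤ (λ t → commonRows≤1 noRect (disjoint s t))) ⟩
    sum (λ (s : Fin w) → sum (λ (t : Fin w) → 1))         ≡⟨ sum-cong-≗ {w} (λ s → trans (sum-const w 1) (*-identityʳ w)) ⟩
    sum (λ (s : Fin w) → w)                               ≡⟨ sum-const w w ⟩
    w * w                                                 ∎
    where
    open ≤-Reasoning
    isC : Fin m → (Fin w → Fin n) → Fin w → ℕ
    isC a cols s = 𝟙[ χ a (cols s) ≡ c ]
    E : Fin m → Fin w → Fin w → ℕ
    E a s t = isC a cols₁ s * isC a cols₂ t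

ℕ→ℚ : ℕ → ℚ
ℕ→ℚ n = + n / 1

ℕ→ℚᵘ : ℕ → ℚᵘ
ℕ→ℚᵘ n = mkℚᵘ (+ n) 0

toℚᵘ-ℕ→ℚ : ∀ n → toℚᵘ (ℕ→ℚ n) ℚᵘ.≃ ℕ→ℚᵘ n
toℚᵘ-ℕ→ℚ n = ℚ.toℚᵘ-fromℚᵘ (ℕ→ℚᵘ n)

ℕ→ℚᵘ-homo-+ : ∀ a b → ℕ→ℚᵘ a ℚᵘ.+ ℕ→ℚᵘ b ℚᵘ.≃ ℕ→ℚᵘ (a + b)
ℕ→ℚᵘ-homo-+ a b =
  *≡* (cong (ℤ._* + 1) (trans (cong₂ ℤ._+_ (ℤ.*-identityʳ (+ a)) (ℤ.*-identityʳ (+ b))) (sym (ℤ.pos-+ a b))))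

ℕ→ℚᵘ-homo-* : ∀ a b → ℕ→ℚᵘ a ℚᵘ.* ℕ→ℚᵘ b ℚᵘ.≃ ℕ→ℚᵘ (a * b)
ℕ→ℚᵘ-homo-* a b = *≡* (cong (ℤ._* + 1) (sym (ℤ.pos-* a b)))

ℕ→ℚ-homo-+ : ∀ a b → ℕ→ℚ a ℚ.+ ℕ→ℚ b ≡ ℕ→ℚ (a + b)
ℕ→ℚ-homo-+ a b = ℚ.toℚᵘ-injective (begin-equality
  toℚᵘ (ℕ→ℚ a ℚ.+ ℕ→ℚ b)               ≃⟨ ℚ.toℚᵘ-homo-+ (ℕ→ℚ a) (ℕ→ℚ b) ⟩
  toℚᵘ (ℕ→ℚ a) ℚᵘ.+ toℚᵘ (ℕ→ℚ b)       ≃⟨ ℚᵘ.+-cong (toℚᵘ-ℕ→ℚ a) (toℚᵘ-ℕ→ℚ b) ⟩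
  ℕ→ℚᵘ a ℚᵘ.+ ℕ→ℚᵘ b                   ≃⟨ ℕ→ℚᵘ-homo-+ a b ⟩
  ℕ→ℚᵘ (a + b)                          ≃⟨ toℚᵘ-ℕ→ℚ (a + b) ⟨
  toℚᵘ (ℕ→ℚ (a + b))                    ∎)
  where open ℚᵘ.≤-Reasoning

ℕ→ℚ-homo-* : ∀ a b → ℕ→ℚ a ℚ.* ℕ→ℚ b ≡ ℕ→ℚ (a * b)
ℕ→ℚ-homo-* a b = ℚ.toℚᵘ-injective (begin-equality
  toℚᵘ (ℕ→ℚ a ℚ.* ℕ→ℚ b)               ≃⟨ ℚ.toℚᵘ-homo-* (ℕ→ℚ a) (ℕ→ℚ b) ⟩
  toℚᵘ (ℕ→ℚ a) ℚᵘ.* toℚᵘ (ℕ→ℚ b)       ≃⟨ ℚᵘ.*-cong (toℚᵘ-ℕ→ℚ a) (toℚᵘ-ℕ→ℚ b) ⟩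
  ℕ→ℚᵘ a ℚᵘ.* ℕ→ℚᵘ b                   ≃⟨ ℕ→ℚᵘ-homo-* a b ⟩
  ℕ→ℚᵘ (a * b)                          ≃⟨ toℚᵘ-ℕ→ℚ (a * b) ⟨
  toℚᵘ (ℕ→ℚ (a * b))                    ∎)
  where open ℚᵘ.≤-Reasoning

ℕ→ℚ-mono-≤ : ∀ {a b} → a ℕ.≤ b → ℕ→ℚ a ≤ ℕ→ℚ b
ℕ→ℚ-mono-≤ {a} {b} a≤b = ℚ.toℚᵘ-cancel-≤ (begin
  toℚᵘ (ℕ→ℚ a)     ≃⟨ toℚᵘ-ℕ→ℚ a ⟩
  ℕ→ℚᵘ a           ≤⟨ *≤* (ℤ.*-monoʳ-≤-nonNeg (+ 1) (ℤ.+≤+ a≤b)) ⟩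
  ℕ→ℚᵘ b           ≃⟨ toℚᵘ-ℕ→ℚ b ⟨
  toℚᵘ (ℕ→ℚ b)     ∎)
  where open ℚᵘ.≤-Reasoning

+[z*n]/z≡ℕ→ℚn : ∀ z .{{_ : NonZero z}} n → + (z * n) / z ≡ ℕ→ℚ n
+[z*n]/z≡ℕ→ℚn (suc z) n = ℚ.fromℚᵘ-cong {mkℚᵘ (+ (suc z * n)) z} {ℕ→ℚᵘ n}
  (*≡* (trans (ℤ.*-identityʳ _) (trans (cong +_ (*-comm (suc z) n)) (ℤ.pos-* n (suc z)))))

sumℚ-ℕ→ℚ : ∀ {n} (f : Fin n → ℕ) {g : Fin n → ℚ} → (∀ i → g i ≡ ℕ→ℚ (f i)) → sumℚ g ≡ ℕ→ℚ (sum f)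
sumℚ-ℕ→ℚ f {g} g≡f = trans (foldr-map-allFin ℚ._+_ ℚ.0ℚ g) (foldr-ℕ→ℚ f g≡f)
  where
  foldr-ℕ→ℚ : ∀ {n} (f : Fin n → ℕ) {g : Fin n → ℚ} → (∀ i → g i ≡ ℕ→ℚ (f i)) →
    Vector.foldr ℚ._+_ ℚ.0ℚ g ≡ ℕ→ℚ (sum f)
  foldr-ℕ→ℚ {zero} f g≡f = refl
  foldr-ℕ→ℚ {suc n} f g≡f =
    trans (cong₂ ℚ._+_ (g≡f zero) (foldr-ℕ→ℚ (f ∘ suc) (g≡f ∘ suc))) (ℕ→ℚ-homo-+ (f zero) (sum (f ∘ suc)))

module _ {p q z k} .{{_ : NonZero z}} (χ : Coloring (p * z) (q * z) k) (c : Fin k) where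

  rowCount : Fin q → Fin (p * z) → ℕ
  rowCount j = colorCount χ c (combine j)

  firstRowCount : Fin p → Fin q → ℕ
  firstRowCount i j = rowCount j (combine i (firstIdx z))

  module _ {i j} (shift : RightShift {p} {q} χ i j) where

    rowCount-rightShift : ∀ r → rowCount j (combine i r) ≡ firstRowCount i j
    rowCount-rightShift r = trans (sum-cong-≗ (λ s → cong (λ x → 𝟙[ x ≡ c ]) (shift r s)))
                                  (sum-shiftIdx (λ s → 𝟙[ blockColor {p} {q} χ i j (firstIdx z) s ≡ c ]) r)

    countBlock-rightShift : countBlock {p} {q} χ c i j ≡ z * firstRowCount i j
    countBlock-rightShift = trans (sumℕ≡sum (λ r → sumℕ (isC r)))
      (trans (sum-cong-≗ (λ r → trans (sumℕ≡sum (isC r)) (rowCount-rightShift r))) (sum-const z _))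
      where
      isC : Fin z → Fin z → ℕ
      isC r s = 𝟙[ blockColor {p} {q} χ i j r s ≡ c ]

    v-rightShift : v {p} {q} χ c i j ≡ ℕ→ℚ (firstRowCount i j)
    v-rightShift = trans (cong (λ x → + x / z) countBlock-rightShift) (+[z*n]/z≡ℕ→ℚn z _)

  module _ (shift : ∀ i j → RightShift {p} {q} χ i j) {j₁ j₂ : Fin q} where

    dot-rightShift : dot {p} {q} χ c j₁ j₂ ≡ ℕ→ℚ (sum (λ i → firstRowCount i j₁ * firstRowCount i j₂))
    dot-rightShift = sumℚ-ℕ→ℚ (λ i → firstRowCount i j₁ * firstRowCount i j₂) (λ i →
      trans (cong₂ ℚ._*_ (v-rightShift (shift i j₁)) (v-rightShift (shift i j₂)))
            (ℕ→ℚ-homo-* (firstRowCount i j₁) (firstRowCount i j₂)))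

    sum-firstRowCount*firstRowCount≤ : NoMonoRect χ → j₁ ≢ j₂ →
      sum (λ i → firstRowCount i j₁ * firstRowCount i j₂) ℕ.≤ z
    sum-firstRowCount*firstRowCount≤ noRect j₁≢j₂ = *-cancelˡ-≤ z (begin
      z * sum (λ i → n₁ i * n₂ i)                              ≡⟨ *-distribˡ-sum z (λ i → n₁ i * n₂ i) ⟩
      sum (λ i → z * (n₁ i * n₂ i))                            ≡⟨ sum-cong-≗ (λ i → sum-const z (n₁ i * n₂ i)) ⟨
      sum (λ i → sum (λ (r : Fin z) → n₁ i * n₂ i))            ≡⟨ sum-cong-≗ (λ i → sum-cong-≗ (λ r → cong₂ _*_
                                                                     (rowCount-rightShift (shift i j₁) r) (rowCount-rightShift (shift i j₂) r))) ⟨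
      sum {p} (λ i → sum {z} (λ r → rowCount j₁ (combine i r) * rowCount j₂ (combine i r)))
                                                               ≡⟨ sum-combine p (λ a → rowCount j₁ a * rowCount j₂ a) ⟨
      sum (λ a → rowCount j₁ a * rowCount j₂ a)                ≤⟨ sum-colorCount*colorCount≤ χ c noRect (combine j₁) (combine j₂) disjoint ⟩
      z * z                                                    ∎)
      where
      open ≤-Reasoning
      n₁ n₂ : Fin p → ℕ
      n₁ i = firstRowCount i j₁
      n₂ i = firstRowCount i j₂
      disjoint : ∀ s t → combine j₁ s ≢ combine j₂ t
      disjoint s t eq = j₁≢j₂ (proj₁ (Finₚ.combine-injective j₁ s j₂ t eq))

proposition6 : (p q z k : ℕ) → .{{_ : NonZero p}} → .{{_ : NonZero q}} →
    .{{_ : NonZero z}} → .{{_ : NonZero k}} →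
    (χ : Coloring (p * z) (q * z) k) →
    NoMonoRect χ →
    ((i : Fin p) (j : Fin q) → RightShift {p} {q} χ i j) →
    (c : Fin k) (j₁ j₂ : Fin q) → j₁ ≢ j₂ →
    dot {p} {q} χ c j₁ j₂ ≤ (+ z) / 1
proposition6 p q z k χ noRect shift c j₁ j₂ j₁≢j₂ =
  ℚ.≤-trans (ℚ.≤-reflexive (dot-rightShift {p} {q} χ c shift))
            (ℕ→ℚ-mono-≤ (sum-firstRowCount*firstRowCount≤ {p} {q} χ c shift noRect j₁≢j₂))
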